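{- Let $\phi$ be a formula and $G$ the weighted graph constructed from it, as described in the context. Let $\mathcal{M}$ be an arbitrary greedy matching of $G$ and let $i\in\{1,\dots,n\}$. Then at most one of the vertices $\alpha_{x_i}$ and $\gamma_{x_i}$ is matched in $\mathcal{M}$ with a vertex of the form $v_j$.
   Context: Greedy matching: for a finite simple undirected graph with positive edge weights and distinct weights $w_1>\dots>w_\ell$, a greedy matching is any matching that can be output by: $\mathcal{M}\leftarrow\emptyset$; for $i=1,\dots,\ell$, while the current edge set contains an edge of weight $w_i$, pick any such edge $e^*$, add it to $\mathcal{M}$, and delete all edges sharing an endpoint with $e^*$. Formula: $\phi$ is a CNF formula over variables $x_1,\dots,x_n$ with clauses $C_1,\dots,C_m$ (in this fixed order), each clause having at most 2 literals, and each variable $x_i$ occurring either exactly twice in $\phi$ (once as $x_i$, once as $\overline{x_i}$) or exactly three times (once as $x_i$, twice as $\overline{x_i}$). Construction of $G$: for each variable $x_i$ take a path on the ten vertices $\beta_{x_i},p_{x_i},q_{x_i},r_{x_i},\alpha_{x_i},\gamma_{x_i},y_{x_i},z_{x_i},s_{x_i},t_{x_i}$ (in this order) with consecutive edge weights $1,3,4,4,4,4,4,3,1$. For each clause $C_j$ add a vertex $v_j$. If $x_i$ occurs positively in $C_j$, add edge $(v_j,\alpha_{x_i})$ of weight 3; if $C_j$ is the first clause in which $\overline{x_i}$ occurs, add edge $(v_j,\beta_{x_i})$ of weight 1; if $C_j$ is the second clause in which $\overline{x_i}$ occurs, add edge $(v_j,\gamma_{x_i})$ of weight 3. There are no other edges.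 -}

module Defs where

open import Data.Nat using (ℕ; zero; suc; _≤_)
open import Data.Fin using (Fin; zero; suc)
open import Data.Fin.Properties using () renaming (_≟_ to _≟F_)
open import Data.Bool using (Bool; true; false; _∨_; not)
open import Data.List using (List; []; _∷_; _++_; length; map; concatMap; filterᵇ; allFin)
open import Data.List.Membership.Propositional using (_∈_)
open import Data.List.Relation.Unary.All using (All)
open import Data.Product using (_×_; _,_; Σ; ∃)
open import Data.Sum using (_⊎_)
open import Relation.Nullary.Decidable using (⌊_⌋)
open import Relation.Binary.PropositionalEquality using (_≡_)

data Lit (n : ℕ) : Set where
  pos : Fin n → Lit n
  neg : Fin n → Lit n

-- A CNF formula with n variables and m clauses C_0 … C_{m-1} (in this order),
-- each clause being a list of literals.
Formula : ℕ → ℕ → Set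
Formula n m = Fin m → List (Lit n)

posCount : ∀ {n} → Fin n → List (Lit n) → ℕ
posCount i [] = 0
posCount i (pos k ∷ ls) with ⌊ i ≟F k ⌋
... | true  = suc (posCount i ls)
... | false = posCount i ls
posCount i (neg k ∷ ls) = posCount i ls

negCount : ∀ {n} → Fin n → List (Lit n) → ℕ
negCount i [] = 0
negCount i (neg k ∷ ls) with ⌊ i ≟F k ⌋
... | true  = suc (negCount i ls)
... | false = negCount i ls
negCount i (pos k ∷ ls) = negCount i ls

occurrences : ∀ {n m} → Formula n m → List (Fin m × Lit n)
occurrences {m = m} φ = concatMap (λ j → map (λ l → (j , l)) (φ j)) (allFin m)

allLits : ∀ {n m} → Formula n m → List (Lit n)
allLits φ = map (λ o → Data.Product.proj₂ o) (occurrences φ)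

WellFormed : ∀ {n m} → Formula n m → Set
WellFormed {n} {m} φ =
  ((j : Fin m) → length (φ j) ≤ 2) ×
  ((i : Fin n) → posCount i (allLits φ) ≡ 1 ×
                 (negCount i (allLits φ) ≡ 1 ⊎ negCount i (allLits φ) ≡ 2))

record Edge (V : Set) : Set where
  constructor edge
  field
    end₁   : V
    end₂   : V
    weight : ℕ
open Edge public

shares : ∀ {V : Set} → (V → V → Bool) → Edge V → Edge V → Bool
shares eq e e' =
  eq (end₁ e) (end₁ e') ∨ eq (end₁ e) (end₂ e') ∨
  eq (end₂ e) (end₁ e') ∨ eq (end₂ e) (end₂ e')

-- Since the algorithm
-- processes the distinct weights in decreasing order and only deletes edges,
-- each selected edge is an edge of maximum weight among the edges still
-- present; after selecting it, all edges sharing an endpoint with it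
-- (including itself) are deleted; the algorithm stops when no edge is left.
data GreedyRun {V : Set} (eq : V → V → Bool) : List (Edge V) → List (Edge V) → Set where
  done : GreedyRun eq [] []
  step : ∀ {E M} (e : Edge V) →
         e ∈ E →
         All (λ e' → weight e' ≤ weight e) E →
         GreedyRun eq (filterᵇ (λ e' → not (shares eq e e')) E) M →
         GreedyRun eq E (e ∷ M)

-- Vertices: var i k is the k-th vertex of the path of x_i, in the order
-- β, p, q, r, α, γ, y, z, s, t  (k = 0 … 9);  cl j is the clause vertex v_j.
data Vertex (n m : ℕ) : Set where
  var : Fin n → Fin 10 → Vertex n m
  cl  : Fin m → Vertex n m

_==V_ : ∀ {n m} → Vertex n m → Vertex n m → Bool
var i k ==V var i' k' = ⌊ i ≟F i' ⌋ Data.Bool.∧ ⌊ k ≟F k' ⌋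
var _ _ ==V cl _      = false
cl _    ==V var _ _   = false
cl j    ==V cl j'     = ⌊ j ≟F j' ⌋

β α γ : ∀ {n m} → Fin n → Vertex n m
β i = var i Data.Fin.zero
α i = var i (Data.Fin.suc (Data.Fin.suc (Data.Fin.suc (Data.Fin.suc Data.Fin.zero))))
γ i = var i (Data.Fin.suc (Data.Fin.suc (Data.Fin.suc (Data.Fin.suc (Data.Fin.suc Data.Fin.zero)))))

pathEdges : ∀ {n m} → Fin n → List (Edge (Vertex n m))
pathEdges i =
  edge (var i v0) (var i v1) 1 ∷ edge (var i v1) (var i v2) 3 ∷
  edge (var i v2) (var i v3) 4 ∷ edge (var i v3) (var i v4) 4 ∷
  edge (var i v4) (var i v5) 4 ∷ edge (var i v5) (var i v6) 4 ∷
  edge (var i v6) (var i v7) 4 ∷ edge (var i v7) (var i v8) 3 ∷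
  edge (var i v8) (var i v9) 1 ∷ []
  where
  v0 v1 v2 v3 v4 v5 v6 v7 v8 v9 : Fin 10
  v0 = zero
  v1 = suc zero
  v2 = suc (suc zero)
  v3 = suc (suc (suc zero))
  v4 = suc (suc (suc (suc zero)))
  v5 = suc (suc (suc (suc (suc zero))))
  v6 = suc (suc (suc (suc (suc (suc zero)))))
  v7 = suc (suc (suc (suc (suc (suc (suc zero))))))
  v8 = suc (suc (suc (suc (suc (suc (suc (suc zero)))))))
  v9 = suc (suc (suc (suc (suc (suc (suc (suc (suc zero))))))))

bump : ∀ {n} → Fin n → (Fin n → ℕ) → Fin n → ℕ
bump i c k with ⌊ i ≟F k ⌋
... | true  = suc (c k)
... | false = c k

-- clause edges; c i = number of occurrences of ¬x_i already processed
-- (in clause order), so the first occurrence of ¬x_i gives the edge to β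
-- (weight 1) and the second the edge to γ (weight 3).
clauseEdges : ∀ {n m} → (Fin n → ℕ) → List (Fin m × Lit n) → List (Edge (Vertex n m))
clauseEdges c [] = []
clauseEdges c ((j , pos i) ∷ os) = edge (cl j) (α i) 3 ∷ clauseEdges c os
clauseEdges c ((j , neg i) ∷ os) = negEdge (c i) ++ clauseEdges (bump i c) os
  where
  negEdge : ℕ → List (Edge _)
  negEdge zero = edge (cl j) (β i) 1 ∷ []
  negEdge (suc zero) = edge (cl j) (γ i) 3 ∷ []
  negEdge (suc (suc _)) = []

graphEdges : ∀ {n m} → Formula n m → List (Edge (Vertex n m))
graphEdges {n} φ = concatMap pathEdges (allFin n) ++ clauseEdges (λ _ → 0) (occurrences φ)

GreedyMatching : ∀ {n m} → Formula n m → List (Edge (Vertex n m)) → Set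
GreedyMatching φ M = GreedyRun _==V_ (graphEdges φ) M

MatchedToClause : ∀ {n m} → List (Edge (Vertex n m)) → Vertex n m → Set
MatchedToClause {m = m} M u =
  Σ (Fin m) λ j → Σ ℕ λ w → (edge u (cl j) w ∈ M) ⊎ (edge (cl j) u w ∈ M)

module Submission where

-- On the path of x_i the vertices α_{x_i} and γ_{x_i} are joined by an
-- edge of weight 4, whereas every edge at a clause vertex v_j weighs at most
-- 3.  Two general facts about greedy runs do the work:
--   * the output is a matching: two selected edges with a common endpoint
--     coincide (selecting an edge deletes every edge touching it);
--   * every edge f of the graph is covered by a selected edge at least as
--     heavy as f (f survives until an edge touching it is selected, and each
--     selected edge has maximum weight among the surviving ones).
-- Applied to f = αγ, some selected edge of weight ≥ 4 covers α or γ; by the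
-- matching property it is the edge by which that vertex is matched, so that
-- vertex cannot be matched with a clause vertex.
--
-- The argument uses no property of φ.

open import Defs
open import Data.Nat using (ℕ; zero; suc; _≤_; s≤s; z≤n)
open import Data.Nat.Properties using (≤-refl; <⇒≱)
open import Data.Fin using (Fin)
open import Data.Fin.Properties using () renaming (_≟_ to _≟F_)
open import Data.Bool using (Bool; true; false; T; not)
open import Data.Bool.Properties using (T-∨; T-∧)
open import Data.List using (List; filterᵇ; map; concatMap; allFin)
open List using ([]; _∷_)
open import Data.List.Membership.Propositional using (_∈_)
open import Data.List.Membership.Propositional.Properties
  using (∈-++⁺ˡ; ∈-++⁻; ∈-filter⁺; ∈-filter⁻; ∈-concatMap⁻; ∈-concat⁺′; ∈-map⁺; ∈-allFin)
open import Data.List.Relation.Unary.Any using (here; there; satisfied)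
open import Data.List.Relation.Unary.All using (All; lookup; []; _∷_)
open import Data.Product using (_×_; _,_; Σ; proj₁; proj₂)
open import Data.Sum using (_⊎_; inj₁; inj₂)
open import Data.Empty using (⊥; ⊥-elim)
open import Function.Bundles using (Equivalence)
open import Relation.Nullary using (¬_; yes; no)
open import Relation.Nullary.Decidable using (⌊_⌋; T?; toWitness; fromWitness)
open import Relation.Binary.PropositionalEquality using (_≡_; refl; cong; cong₂)

open Equivalence using (to; from)

Touches : ∀ {V : Set} → V → Edge V → Set
Touches x e = end₁ e ≡ x ⊎ end₂ e ≡ x

Covers : ∀ {V : Set} → Edge V → Edge V → Set
Covers e f = Touches (end₁ f) e ⊎ Touches (end₂ f) e

not-excludes : ∀ b → T (not b) → ¬ T b
not-excludes true  ()
not-excludes false _ ()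

not-intro : ∀ b → ¬ T b → T (not b)
not-intro true  ¬b = ¬b _
not-intro false _  = _

module Greedy {V : Set} (eq : V → V → Bool)
              (eq-refl : ∀ x → T (eq x x))
              (eq-sound : ∀ x y → T (eq x y) → x ≡ y) where

  shares-of-common : ∀ {x} e e' → Touches x e → Touches x e' → T (shares eq e e')
  shares-of-common (edge a b _) (edge _ _ _) (inj₁ refl) (inj₁ refl) =
    from (T-∨ {eq a a}) (inj₁ (eq-refl a))
  shares-of-common (edge a b _) (edge c _ _) (inj₁ refl) (inj₂ refl) =
    from (T-∨ {eq a c}) (inj₂ (from (T-∨ {eq a a}) (inj₁ (eq-refl a))))
  shares-of-common (edge a b _) (edge _ d _) (inj₂ refl) (inj₁ refl) =
    from (T-∨ {eq a b}) (inj₂ (from (T-∨ {eq a d}) (inj₂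
      (from (T-∨ {eq b b}) (inj₁ (eq-refl b))))))
  shares-of-common (edge a b _) (edge c _ _) (inj₂ refl) (inj₂ refl) =
    from (T-∨ {eq a c}) (inj₂ (from (T-∨ {eq a b}) (inj₂
      (from (T-∨ {eq b c}) (inj₂ (eq-refl b))))))

  common-of-shares : ∀ e f → T (shares eq e f) → Covers e f
  common-of-shares (edge a b _) (edge c d _) s with to (T-∨ {eq a c}) s
  ... | inj₁ ac = inj₁ (inj₁ (eq-sound a c ac))
  ... | inj₂ s₁ with to (T-∨ {eq a d}) s₁
  ... | inj₁ ad = inj₂ (inj₁ (eq-sound a d ad))
  ... | inj₂ s₂ with to (T-∨ {eq b c}) s₂
  ... | inj₁ bc = inj₁ (inj₂ (eq-sound b c bc))
  ... | inj₂ bd = inj₂ (inj₂ (eq-sound b d bd))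

  Survivors : Edge V → List (Edge V) → List (Edge V)
  Survivors e = filterᵇ (λ e' → not (shares eq e e'))

  ∈-Survivors⁻ : ∀ {f} e E → f ∈ Survivors e E → f ∈ E × T (not (shares eq e f))
  ∈-Survivors⁻ e E = ∈-filter⁻ (λ e' → T? (not (shares eq e e'))) {xs = E}

  ∈-Survivors⁺ : ∀ {f} e E → f ∈ E → ¬ T (shares eq e f) → f ∈ Survivors e E
  ∈-Survivors⁺ {f} e E f∈E ¬s =
    ∈-filter⁺ (λ e' → T? (not (shares eq e e'))) f∈E (not-intro (shares eq e f) ¬s)

  survivor-disjoint : ∀ {x f} e E → f ∈ Survivors e E → Touches x e → Touches x f → ⊥
  survivor-disjoint {f = f} e E f∈ te tf =
    not-excludes (shares eq e f) (proj₂ (∈-Survivors⁻ e E f∈)) (shares-of-common e f te tf)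

  selected-⊆ : ∀ {E M e} → GreedyRun eq E M → e ∈ M → e ∈ E
  selected-⊆ (step e e∈E _ _) (here refl) = e∈E
  selected-⊆ {E} (step e _ _ run) (there e∈M) = proj₁ (∈-Survivors⁻ e E (selected-⊆ run e∈M))

  matching : ∀ {E M x e e'} → GreedyRun eq E M → e ∈ M → e' ∈ M →
             Touches x e → Touches x e' → e ≡ e'
  matching (step _ _ _ _) (here refl) (here refl) _ _ = refl
  matching {E} {x = x} (step e _ _ run) (here refl) (there e'∈M) t t' =
    ⊥-elim (survivor-disjoint {x} e E (selected-⊆ run e'∈M) t t')
  matching {E} {x = x} (step e' _ _ run) (there e∈M) (here refl) t t' =
    ⊥-elim (survivor-disjoint {x} e' E (selected-⊆ run e∈M) t' t)
  matching (step _ _ _ run) (there e∈M) (there e'∈M) t t' = matching run e∈M e'∈M t t'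

  heavily-covered : ∀ {E M f} → GreedyRun eq E M → f ∈ E →
                    Σ (Edge V) λ e → e ∈ M × Covers e f × weight f ≤ weight e
  heavily-covered done ()
  heavily-covered {E} {f = f} (step e _ maximal run) f∈E with T? (shares eq e f)
  ... | yes s = e , here refl , common-of-shares e f s , lookup maximal f∈E
  ... | no ¬s with heavily-covered run (∈-Survivors⁺ e E f∈E ¬s)
  ...   | e' , e'∈M , covers , heavier = e' , there e'∈M , covers , heavier

==V-refl : ∀ {n m} (x : Vertex n m) → T (x ==V x)
==V-refl (var i k) = from (T-∧ {⌊ i ≟F i ⌋}) (fromWitness {a? = i ≟F i} refl ,
                                               fromWitness {a? = k ≟F k} refl)
==V-refl (cl j)    = fromWitness {a? = j ≟F j} refl

==V-sound : ∀ {n m} (x y : Vertex n m) → T (x ==V y) → x ≡ y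
==V-sound (var i k) (var i' k') h with to (T-∧ {⌊ i ≟F i' ⌋}) h
... | same-i , same-k = cong₂ var (toWitness same-i) (toWitness same-k)
==V-sound (cl j) (cl j') h = cong cl (toWitness h)

module GreedyG {n m : ℕ} = Greedy (_==V_ {n} {m}) ==V-refl ==V-sound
open GreedyG

αγ∈G : ∀ {n m} (φ : Formula n m) (i : Fin n) → edge (α i) (γ i) 4 ∈ graphEdges φ
αγ∈G {n} φ i = ∈-++⁺ˡ (∈-concat⁺′ {xss = map pathEdges (allFin n)}
                         (there (there (there (there (here refl)))))
                         (∈-map⁺ pathEdges (∈-allFin i)))

clause-edges-light : ∀ {n m} (c : Fin n → ℕ) (os : List (Fin m × Lit n)) →
                     All (λ e → weight e ≤ 3) (clauseEdges c os)
clause-edges-light c List.[] = []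
clause-edges-light c ((j , pos i) ∷ os) = ≤-refl ∷ clause-edges-light c os
clause-edges-light c ((j , neg i) ∷ os) with c i
... | zero        = s≤s z≤n ∷ clause-edges-light (bump i c) os
... | suc zero    = ≤-refl ∷ clause-edges-light (bump i c) os
... | suc (suc _) = clause-edges-light (bump i c) os

path-avoids-clauses : ∀ {n m} (i : Fin n) (j : Fin m) →
                      All (λ e → ¬ Touches (cl j) e) (pathEdges i)
path-avoids-clauses {n} i j = p ∷ p ∷ p ∷ p ∷ p ∷ p ∷ p ∷ p ∷ p ∷ []
  where
  p : ∀ {a b : Fin n} {k k' : Fin 10} → ¬ (var a k ≡ cl j ⊎ var b k' ≡ cl j)
  p (inj₁ ())
  p (inj₂ ())

clause-edge-light : ∀ {n m} (φ : Formula n m) {e} {j : Fin m} →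
                    e ∈ graphEdges φ → Touches (cl j) e → weight e ≤ 3
clause-edge-light {n} φ {j = j} e∈G at-clause with ∈-++⁻ (concatMap pathEdges (allFin n)) e∈G
... | inj₁ e∈path with satisfied (∈-concatMap⁻ pathEdges {xs = allFin n} e∈path)
...   | i , e∈pathᵢ = ⊥-elim (lookup (path-avoids-clauses i j) e∈pathᵢ at-clause)
clause-edge-light φ e∈G at-clause | inj₂ e∈clauses =
  lookup (clause-edges-light (λ _ → 0) (occurrences φ)) e∈clauses

clause-matched-light : ∀ {n m} {φ : Formula n m} {M u e} → GreedyMatching φ M →
                       MatchedToClause M u → e ∈ M → Touches u e → weight e ≤ 3
clause-matched-light {φ = φ} greedy (j , w , inj₁ uv∈M) e∈M at-u
  with matching greedy e∈M uv∈M at-u (inj₁ refl)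
... | refl = clause-edge-light φ (selected-⊆ greedy uv∈M) (inj₂ refl)
clause-matched-light {φ = φ} greedy (j , w , inj₂ vu∈M) e∈M at-u
  with matching greedy e∈M vu∈M at-u (inj₂ refl)
... | refl = clause-edge-light φ (selected-⊆ greedy vu∈M) (inj₁ refl)

lemma2 : ∀ {n m} (φ : Formula n m) → WellFormed φ →
    (M : List (Edge (Vertex n m))) → GreedyMatching φ M →
    (i : Fin n) → ¬ (MatchedToClause M (α i) × MatchedToClause M (γ i))
lemma2 φ _ M greedy i (α-to-clause , γ-to-clause) with heavily-covered greedy (αγ∈G φ i)
... | e , e∈M , inj₁ at-α , heavy = <⇒≱ heavy (clause-matched-light greedy α-to-clause e∈M at-α)
... | e , e∈M , inj₂ at-γ , heavy = <⇒≱ heavy (clause-matched-light greedy γ-to-clause e∈M at-γ)
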